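{- Let $E$ be a set with designated $\phi$-classes such that $(E,\phi)$ is a geometrical system in the generalized sense of Whitehead. Let $v\subseteq E$ be $\phi$-prime, and let $x\in E$ be such that $v\cup\{x\}$ is $\phi$-maximal and $x\notin \operatorname{cm}_\phi(v)$. Then $v$ and $v\cup\{x\}$ are $\phi$-axial, and $\dim_\phi(v\cup\{x\})=\dim_\phi(v)+1$.
   Context: Whitehead's terminology. Let $E$ be a set and let some subsets of $E$ be designated as $\phi$-classes. For $u\subseteq E$, the $\phi$-common region $\operatorname{cm}_\phi(u)$ is the intersection of all $\phi$-classes containing $u$ (the intersection of the empty family being $E$). Two subsets $u,v\subseteq E$ are $\phi$-equivalent if $\operatorname{cm}_\phi(u)=\operatorname{cm}_\phi(v)$. A nonempty set $u\subseteq E$ is $\phi$-prime if no proper subset of $u$ has the same $\phi$-common region as $u$. A $\phi$-prime set is $\phi$-axial if it has the largest cardinality among all $\phi$-prime sets having the same $\phi$-common region. For nonempty $u\subseteq E$, the $\phi$-dimension number $\dim_\phi(u)$ is the cardinality of a $\phi$-axial set that is $\phi$-equivalent to $u$. A nonempty set $u\subseteq E$ is $\phi$-maximal if every $\phi$-prime subset of $u$ that is $\phi$-equivalent to $u$ is $\phi$-axial. $(E,\phi)$ is a geometrical system in the generalized sense of Whitehead if: ($\lambda$) $E$ is a $\phi$-class; ($\mu$) for every $x\in E$ the singleton $\{x\}$ is a $\phi$-class; ($\nu'$) $\dim_\phi(E)$ is finite and $\operatorname{cm}_\phi(\emptyset)=\emptyset$; ($\pi$) for every $u\subseteq E$ and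 every $\phi$-axial subset $v$ of $\operatorname{cm}_\phi(u)$, there exists $w\subseteq E$ such that $v\cup w$ is $\phi$-axial and $\phi$-equivalent to $u$; ($\rho$) for all $\phi$-axial $u,v\subseteq E$ with $|u\cap v|\ge 2$, the set $u\cup v$ is $\phi$-maximal. -}

module Defs where

open import Level using (0ℓ)
open import Data.Nat using (ℕ)
open import Data.Fin using (Fin)
open import Data.Product using (Σ; ∃; ∃-syntax; _×_; _,_)
open import Relation.Nullary using (¬_)
open import Relation.Unary using (Pred; _⊆_; _≐_; _∪_; _∩_; ｛_｝; ∅; U; Satisfiable)
open import Relation.Binary.PropositionalEquality using (_≡_; _≢_)

-- Cardinality comparisons between subsets of a type E (membership proofs
-- need not be unique, so maps are injective on the underlying elements).

CardLeq : {E : Set} → Pred E 0ℓ → Pred E 0ℓ → Set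
CardLeq {E} u w =
  Σ ((x : E) → u x → E) λ f →
    ((x : E) (p : u x) → w (f x p)) ×
    ((x y : E) (p : u x) (q : u y) → f x p ≡ f y q → x ≡ y)

CardEq : {E : Set} → Pred E 0ℓ → Pred E 0ℓ → Set
CardEq {E} u w =
  Σ ((x : E) → u x → E) λ f →
    ((x : E) (p : u x) → w (f x p)) ×
    ((x y : E) (p : u x) (q : u y) → f x p ≡ f y q → x ≡ y) ×
    ((y : E) → w y → ∃[ x ] Σ (u x) λ p → f x p ≡ y)

-- |w| = |u| + 1 (as cardinals): removing one element of w leaves a set
-- equipotent to u
CardSucc : {E : Set} → Pred E 0ℓ → Pred E 0ℓ → Set
CardSucc {E} u w = ∃[ y ] (w y × CardEq u (λ z → w z × z ≢ y))

HasCard : {E : Set} → Pred E 0ℓ → ℕ → Set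
HasCard {E} u n =
  Σ (Fin n → E) λ g →
    ((i : Fin n) → u (g i)) ×
    ((i j : Fin n) → g i ≡ g j → i ≡ j) ×
    ((y : E) → u y → ∃[ i ] g i ≡ y)

module Whitehead {E I : Set} (C : I → Pred E 0ℓ) where

  cm : Pred E 0ℓ → Pred E 0ℓ
  cm u x = (i : I) → u ⊆ C i → C i x

  Equiv : Pred E 0ℓ → Pred E 0ℓ → Set
  Equiv u v = cm u ≐ cm v

  Nonempty : Pred E 0ℓ → Set
  Nonempty u = Satisfiable u

  Prime : Pred E 0ℓ → Set₁
  Prime u = Nonempty u ×
    ((w : Pred E 0ℓ) → w ⊆ u → ¬ (u ⊆ w) → ¬ (cm w ≐ cm u))

  Axial : Pred E 0ℓ → Set₁
  Axial u = Prime u ×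
    ((w : Pred E 0ℓ) → Prime w → cm w ≐ cm u → CardLeq w u)

  -- a is a witness for dim_φ(u): an axial set φ-equivalent to u
  -- (dim_φ(u) is the cardinality of any such a)
  DimRep : Pred E 0ℓ → Pred E 0ℓ → Set₁
  DimRep u a = Axial a × Equiv a u

  Maximal : Pred E 0ℓ → Set₁
  Maximal u = Nonempty u ×
    ((w : Pred E 0ℓ) → w ⊆ u → Prime w → Equiv w u → Axial w)

  record GeometricalSystem : Set₁ where
    field
      λ-ax : ∃[ i ] (C i ≐ U)
      μ-ax : (x : E) → ∃[ i ] (C i ≐ ｛ x ｝)
      ν-dim : ∃[ a ] ∃[ n ] (DimRep U a × HasCard a n)
      ν-empty : cm ∅ ≐ ∅
      π-ax : (u v : Pred E 0ℓ) → v ⊆ cm u → Axial v →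
             ∃[ w ] (Axial (v ∪ w) × Equiv (v ∪ w) u)
      ρ-ax : (u v : Pred E 0ℓ) → Axial u → Axial v →
             (∃[ a ] ∃[ b ] (a ≢ b × (u ∩ v) a × (u ∩ v) b)) →
             Maximal (u ∪ v)

{-# OPTIONS --safe #-}
module Submission where

-- Prime sets are finite: a prime set injects into an axial set with the same common region
-- (axiom π applied to one of its points), and every axial set injects into an axial set
-- for E, which has dim E elements. Take A axial with the same common region as v, and a
-- prime p ⊆ v ∪ {x} with the same common region as v ∪ {x}; p is axial because v ∪ {x}
-- is maximal. Extending A by π to an axial set for v ∪ {x} adds a point outside A, since
-- x ∉ cm v. Hence |v| ≤ |A| < |p| ≤ |v| + 1, so |A| = |v|, which makes v axial, and
-- |p| = |v ∪ {x}|, which forces p = v ∪ {x}.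

open import Defs
open import Level using (0ℓ; lift; lower)
open import Axiom.ExcludedMiddle using (ExcludedMiddle)
open import Axiom.DoubleNegationElimination using (em⇒dne)
open import Data.Nat using (ℕ; zero; suc; _≤_; _<_; s≤s)
open import Data.Nat.Properties using (≤-trans; ≤-antisym; ≤-pred; <-≤-trans; <-irrefl)
open import Data.Fin using (Fin; zero; suc; punchOut; inject≤)
open import Data.Fin.Properties
  using (¬Fin0; 0≢1+n; punchOut-injective; injective⇒≤; inject≤-injective; suc-injective)
open import Data.Product using (Σ; ∃-syntax; _×_; _,_; proj₁; proj₂)
open import Data.Sum using (inj₁; inj₂)
open import Data.Empty using (⊥-elim)
open import Function using (_∘_; id)
open import Relation.Nullary using (¬_; yes; no)
open import Relation.Nullary.Decidable using (map′)
open import Relation.Unary using (Pred; _⊆_; _⊂_; _≐_; _∪_; _∖_; ｛_｝; ∅; U)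
open import Relation.Unary.Properties using (⊆-U; ≐-refl; ≐-sym; ≐-trans)
open import Relation.Binary.PropositionalEquality using (_≡_; _≢_; refl; sym; trans; cong; subst)

private
  variable
    E : Set
    s t w : Pred E 0ℓ
    m k N : ℕ
    y : E

lower-em : ExcludedMiddle (Level.suc 0ℓ) → ExcludedMiddle 0ℓ
lower-em em = map′ lower lift em

FinBounded : Pred E 0ℓ → ℕ → Set
FinBounded {E} s N = Σ ((z : E) → s z → Fin N) λ F →
  (z z′ : E) (p : s z) (p′ : s z′) → F z p ≡ F z′ p′ → z ≡ z′

⊆⇒CardLeq : s ⊆ t → CardLeq s t
⊆⇒CardLeq s⊆t = (λ z _ → z) , (λ _ → s⊆t) , (λ _ _ _ _ → id)

CardLeq-trans : {r : Pred E 0ℓ} → CardLeq s t → CardLeq t r → CardLeq s r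
CardLeq-trans (f , f∈ , f-inj) (g , g∈ , g-inj) =
  (λ z p → g (f z p) (f∈ z p)) , (λ z p → g∈ (f z p) (f∈ z p)) ,
  (λ z z′ p p′ → f-inj z z′ p p′ ∘ g-inj _ _ _ _)

CardLeq-FinBounded : CardLeq s t → FinBounded t N → FinBounded s N
CardLeq-FinBounded (f , f∈ , f-inj) (F , F-inj) =
  (λ z p → F (f z p) (f∈ z p)) , (λ z z′ p p′ → f-inj z z′ p p′ ∘ F-inj _ _ _ _)

HasCard⇒FinBounded : HasCard s N → FinBounded s N
HasCard⇒FinBounded (g , _ , _ , g-onto) =
  (λ z p → proj₁ (g-onto z p)) ,
  (λ z z′ p p′ eq →
     trans (sym (proj₂ (g-onto z p))) (trans (cong g eq) (proj₂ (g-onto z′ p′))))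

FinBounded-remove : FinBounded s (suc N) → s y → w ⊆ s → ¬ w y → FinBounded w N
FinBounded-remove {s = s} {y = y} {w = w} (F , F-inj) sy w⊆s y∉w =
  (λ z wz → punchOut (Fy≢ z wz)) ,
  (λ z z′ p p′ → F-inj _ _ _ _ ∘ punchOut-injective (Fy≢ z p) (Fy≢ z′ p′))
  where
  Fy≢ : (z : _) (wz : w z) → F y sy ≢ F z (w⊆s wz)
  Fy≢ z wz eq = y∉w (subst w (sym (F-inj _ _ _ _ eq)) wz)

HasCard-CardLeq⇒≤ : HasCard s m → HasCard t k → CardLeq s t → m ≤ k
HasCard-CardLeq⇒≤ (g , g∈ , g-inj , _) t-card s↣t
  with CardLeq-FinBounded s↣t (HasCard⇒FinBounded t-card)
... | F , F-inj = injective⇒≤ {f = λ i → F (g i) (g∈ i)} (λ {i} {j} → g-inj i j ∘ F-inj _ _ _ _)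

≤⇒CardLeq : HasCard s m → HasCard t k → m ≤ k → CardLeq s t
≤⇒CardLeq (g , _ , _ , g-onto) (h , h∈ , h-inj , _) m≤k =
  (λ z p → h (inject≤ (proj₁ (g-onto z p)) m≤k)) ,
  (λ _ _ → h∈ _) ,
  (λ z z′ p p′ eq → trans (sym (proj₂ (g-onto z p)))
     (trans (cong g (inject≤-injective m≤k m≤k _ _ (h-inj _ _ eq))) (proj₂ (g-onto z′ p′))))

HasCard-resp-≐ : s ≐ t → HasCard s N → HasCard t N
HasCard-resp-≐ (s⊆t , t⊆s) (g , g∈ , g-inj , g-onto) =
  g , (λ i → s⊆t (g∈ i)) , g-inj , (λ z tz → g-onto z (t⊆s tz))

⊆∅⇒HasCard0 : s ⊆ ∅ → HasCard s 0
⊆∅⇒HasCard0 s⊆∅ = (λ ()) , (λ ()) , (λ ()) , (λ _ sz → ⊥-elim (s⊆∅ sz))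

HasCard-∪-｛｝ : {x : E} → HasCard s m → ¬ s x → HasCard (s ∪ ｛ x ｝) (suc m)
HasCard-∪-｛｝ {s = s} {m = m} {x = x} (g , g∈ , g-inj , g-onto) x∉s = h , h∈ , h-inj , h-onto
  where
  h : Fin (suc m) → _
  h zero = x
  h (suc i) = g i
  h∈ : (i : Fin (suc m)) → (s ∪ ｛ x ｝) (h i)
  h∈ zero = inj₂ refl
  h∈ (suc i) = inj₁ (g∈ i)
  h-inj : (i j : Fin (suc m)) → h i ≡ h j → i ≡ j
  h-inj zero zero _ = refl
  h-inj zero (suc j) eq = ⊥-elim (x∉s (subst s (sym eq) (g∈ j)))
  h-inj (suc i) zero eq = ⊥-elim (x∉s (subst s eq (g∈ i)))
  h-inj (suc i) (suc j) eq = cong suc (g-inj i j eq)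
  h-onto : (z : _) → (s ∪ ｛ x ｝) z → ∃[ i ] h i ≡ z
  h-onto z (inj₁ sz) = suc (proj₁ (g-onto z sz)) , proj₂ (g-onto z sz)
  h-onto z (inj₂ x≡z) = zero , x≡z

HasCard⇒CardSucc : HasCard s k → HasCard t (suc k) → CardSucc s t
HasCard⇒CardSucc {s = s} {t = t} (g , g∈ , g-inj , g-onto) (h , h∈ , h-inj , h-onto) =
  h zero , h∈ zero , f , f∈ , f-inj , f-onto
  where
  f : (z : _) → s z → _
  f z p = h (suc (proj₁ (g-onto z p)))
  f∈ : (z : _) (p : s z) → t (f z p) × f z p ≢ h zero
  f∈ z p = h∈ _ , (λ eq → 0≢1+n (sym (h-inj _ _ eq)))
  f-inj : (z z′ : _) (p : s z) (p′ : s z′) → f z p ≡ f z′ p′ → z ≡ z′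
  f-inj z z′ p p′ eq = trans (sym (proj₂ (g-onto z p)))
    (trans (cong g (suc-injective (h-inj _ _ eq))) (proj₂ (g-onto z′ p′)))
  f-onto : (z : _) → t z × z ≢ h zero → ∃[ z′ ] Σ (s z′) λ p → f z′ p ≡ z
  f-onto z (tz , z≢h0) with h-onto z tz
  ... | zero , eq = ⊥-elim (z≢h0 (sym eq))
  ... | suc j , eq = g j , g∈ j , trans (cong (h ∘ suc) (g-inj _ _ (proj₂ (g-onto (g j) (g∈ j))))) eq

module Classical (em : ExcludedMiddle 0ℓ) where

  ⊈⇒∃ : ¬ s ⊆ t → ∃[ y ] (s y × ¬ t y)
  ⊈⇒∃ s⊈t = em⇒dne em λ ∄ → s⊈t λ {y} sy → em⇒dne em λ y∉t → ∄ (y , sy , y∉t)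

  FinBounded⇒HasCard : (N : ℕ) → FinBounded s N → ∃[ k ] HasCard s k
  FinBounded⇒HasCard zero (F , _) = 0 , ⊆∅⇒HasCard0 (λ sz → ¬Fin0 (F _ sz))
  FinBounded⇒HasCard {s = s} (suc N) s-bounded with em {∃[ y ] s y}
  ... | no ∄ = 0 , ⊆∅⇒HasCard0 (λ sz → ∄ (_ , sz))
  ... | yes (y , sy)
    with FinBounded⇒HasCard N (FinBounded-remove s-bounded sy proj₁ (λ (_ , y≢y) → y≢y refl))
  ...   | k , rest-card =
    suc k , HasCard-resp-≐ (restore , split) (HasCard-∪-｛｝ rest-card (λ (_ , y≢y) → y≢y refl))
    where
    restore : (s ∖ ｛ y ｝) ∪ ｛ y ｝ ⊆ s
    restore (inj₁ (sz , _)) = sz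
    restore (inj₂ refl) = sy
    split : s ⊆ (s ∖ ｛ y ｝) ∪ ｛ y ｝
    split {z} sz with em {y ≡ z}
    ... | yes y≡z = inj₂ y≡z
    ... | no y≢z = inj₁ (sz , y≢z)

  ⊂⇒< : s ⊂ t → HasCard s m → HasCard t k → m < k
  ⊂⇒< {s = s} {t = t} (s⊆t , t⊈s) s-card t-card with ⊈⇒∃ t⊈s
  ... | y , ty , y∉s = HasCard-CardLeq⇒≤ (HasCard-∪-｛｝ s-card y∉s) t-card (⊆⇒CardLeq extend)
    where
    extend : s ∪ ｛ y ｝ ⊆ t
    extend (inj₁ sz) = s⊆t sz
    extend (inj₂ refl) = ty

  ⊆-≥⇒⊇ : s ⊆ t → HasCard s m → HasCard t k → k ≤ m → t ⊆ s
  ⊆-≥⇒⊇ s⊆t s-card t-card k≤m tz =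
    em⇒dne em (λ t⊈s → <-irrefl refl (<-≤-trans (⊂⇒< (s⊆t , t⊈s) s-card t-card) k≤m)) tz

module CommonRegion {E I : Set} (C : I → Pred E 0ℓ) where
  open Whitehead C

  ⊆-cm : (u : Pred E 0ℓ) → u ⊆ cm u
  ⊆-cm u uz i u⊆Ci = u⊆Ci uz

  cm-mono : {u v : Pred E 0ℓ} → u ⊆ v → cm u ⊆ cm v
  cm-mono u⊆v cmuz i v⊆Ci = cmuz i (v⊆Ci ∘ u⊆v)

  Prime-resp-≐ : {u v : Pred E 0ℓ} → u ≐ v → Prime u → Prime v
  Prime-resp-≐ (u⊆v , v⊆u) ((z , uz) , minimal) =
    (z , u⊆v uz) ,
    (λ w w⊆v v⊈w w≈v →
       minimal w (λ wz → v⊆u (w⊆v wz)) (λ u⊆w → v⊈w (λ vz → u⊆w (v⊆u vz)))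
                 (≐-trans w≈v (cm-mono v⊆u , cm-mono u⊆v)))

module Geometry (em : ExcludedMiddle (Level.suc 0ℓ)) {E I : Set} (C : I → Pred E 0ℓ)
                (G : Whitehead.GeometricalSystem C) where
  open Whitehead C
  open GeometricalSystem G
  open CommonRegion C
  open Classical (lower-em em)

  cm⇒Nonempty : {u : Pred E 0ℓ} {z : E} → cm u z → Nonempty u
  cm⇒Nonempty cmuz =
    em⇒dne (lower-em em) λ ∄ → proj₁ ν-empty (cm-mono (λ uz → ∄ (_ , uz)) cmuz)

  ｛｝-axial : (y : E) → Axial ｛ y ｝
  ｛｝-axial y = ((y , refl) , minimal) , (λ w _ w≈y → ⊆⇒CardLeq (inside w≈y))
    where
    minimal : (w : Pred E 0ℓ) → w ⊆ ｛ y ｝ → ¬ (｛ y ｝ ⊆ w) → ¬ (cm w ≐ cm ｛ y ｝)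
    minimal w w⊆y y⊈w w≈y with cm⇒Nonempty (proj₂ w≈y (⊆-cm ｛ y ｝ refl))
    ... | z , wz = y⊈w (λ y≡z′ → subst w (trans (sym (w⊆y wz)) y≡z′) wz)
    inside : {w : Pred E 0ℓ} → cm w ≐ cm ｛ y ｝ → w ⊆ ｛ y ｝
    inside {w} w≈y wz with μ-ax y
    ... | i , Ci≐y = proj₁ Ci≐y (proj₁ w≈y (⊆-cm w wz) i (proj₂ Ci≐y))

  Nonempty⇒∃DimRep : {u : Pred E 0ℓ} → Nonempty u → ∃[ a ] DimRep u a
  Nonempty⇒∃DimRep {u} (y , uy) with π-ax u ｛ y ｝ (λ { refl → ⊆-cm u uy }) (｛｝-axial y)
  ... | w , rep = ｛ y ｝ ∪ w , rep

  axial-bounded : ∃[ N ] ({a : Pred E 0ℓ} → Axial a → FinBounded a N)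
  axial-bounded with ν-dim
  ... | e , N , (e-axial , e≈U) , e-card = N , bounded
    where
    bounded : {a : Pred E 0ℓ} → Axial a → FinBounded a N
    bounded {a} a-axial with π-ax U a (λ az → ⊆-cm U (⊆-U a az)) a-axial
    ... | w , aw-axial , aw≈U =
      CardLeq-FinBounded
        (CardLeq-trans {r = e} (⊆⇒CardLeq {t = a ∪ w} inj₁)
                       (proj₂ e-axial (a ∪ w) (proj₁ aw-axial) (≐-trans aw≈U (≐-sym e≈U))))
        (HasCard⇒FinBounded e-card)

  Prime⇒finite : {u : Pred E 0ℓ} → Prime u → ∃[ k ] HasCard u k
  Prime⇒finite {u} u-prime with Nonempty⇒∃DimRep (proj₁ u-prime) | axial-bounded
  ... | a , a-axial , a≈u | N , bounded =
    FinBounded⇒HasCard N (CardLeq-FinBounded (proj₂ a-axial u u-prime (≐-sym a≈u)) (bounded a-axial))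

  prime-core : {u : Pred E 0ℓ} (N : ℕ) → FinBounded u N → Nonempty u →
               ∃[ p ] (p ⊆ u × Prime p × cm p ≐ cm u)
  prime-core zero (F , _) (z , uz) = ⊥-elim (¬Fin0 (F z uz))
  prime-core {u} (suc N) u-bounded u-nonempty with em {∃[ w ] (w ⊆ u × ¬ u ⊆ w × cm w ≐ cm u)}
  ... | no ∄ = u , id , (u-nonempty , λ w w⊆u u⊈w w≈u → ∄ (w , w⊆u , u⊈w , w≈u)) , ≐-refl
  ... | yes (w , w⊆u , u⊈w , w≈u) with ⊈⇒∃ u⊈w
  ...   | z , uz , z∉w with prime-core N (FinBounded-remove u-bounded uz w⊆u z∉w)
                                        (cm⇒Nonempty (proj₂ w≈u (⊆-cm u uz)))
  ...     | p , p⊆w , p-prime , p≈w = p , (λ pz → w⊆u (p⊆w pz)) , p-prime , ≐-trans p≈w w≈u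

  Axial-≤ : {a p : Pred E 0ℓ} {k n : ℕ} → Axial a → Prime p → cm p ≐ cm a →
            HasCard p k → HasCard a n → k ≤ n
  Axial-≤ a-axial p-prime p≈a p-card a-card =
    HasCard-CardLeq⇒≤ p-card a-card (proj₂ a-axial _ p-prime p≈a)

  DimRep-HasCard : {u a : Pred E 0ℓ} {n : ℕ} → Axial u → DimRep u a → HasCard u n → HasCard a n
  DimRep-HasCard {a = a} u-axial (a-axial , a≈u) u-card with Prime⇒finite (proj₁ a-axial)
  ... | k , a-card = subst (HasCard a)
    (≤-antisym (Axial-≤ u-axial (proj₁ a-axial) a≈u a-card u-card)
               (Axial-≤ a-axial (proj₁ u-axial) (≐-sym a≈u) u-card a-card)) a-card

  DimRep-CardLeq⇒Axial : {v a : Pred E 0ℓ} → Prime v → DimRep v a → CardLeq a v → Axial v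
  DimRep-CardLeq⇒Axial {v} v-prime (a-axial , a≈v) a↣v =
    v-prime ,
    λ w w-prime w≈v →
      CardLeq-trans {r = v} (proj₂ a-axial w w-prime (≐-trans w≈v (≐-sym a≈v))) a↣v

  dim-< : {u v a b : Pred E 0ℓ} {α β : ℕ} → v ⊆ u → ¬ (u ⊆ cm v) →
          DimRep v a → DimRep u b → HasCard a α → HasCard b β → α < β
  dim-< {u} {v} {a} v⊆u u⊈cmv (a-axial , a≈v) (b-axial , b≈u) a-card b-card
    with π-ax u a (λ az → cm-mono v⊆u (proj₁ a≈v (⊆-cm a az))) a-axial
  ... | w , aw-axial , aw≈u with Prime⇒finite (proj₁ aw-axial)
  ...   | _ , aw-card =
    <-≤-trans (⊂⇒< (inj₁ , aw⊈a) a-card aw-card)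
              (Axial-≤ b-axial (proj₁ aw-axial) (≐-trans aw≈u (≐-sym b≈u)) aw-card b-card)
    where
    aw⊈a : ¬ (a ∪ w ⊆ a)
    aw⊈a aw⊆a = u⊈cmv (λ uz → proj₁ a≈v (cm-mono aw⊆a (proj₂ aw≈u (⊆-cm u uz))))

lemma1 : ExcludedMiddle (Level.suc 0ℓ) →
    {E I : Set} (C : I → Pred E 0ℓ) →
    Whitehead.GeometricalSystem C →
    (v : Pred E 0ℓ) (x : E) →
    Whitehead.Prime C v →
    Whitehead.Maximal C (v ∪ ｛ x ｝) →
    ¬ Whitehead.cm C v x →
    Whitehead.Axial C v × Whitehead.Axial C (v ∪ ｛ x ｝) ×
    ((a b : Pred E 0ℓ) → Whitehead.DimRep C v a →
    Whitehead.DimRep C (v ∪ ｛ x ｝) b → CardSucc a b)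
lemma1 em C G v x v-prime (_ , u-maximal) x∉cmv =
  let open CommonRegion C
      open Geometry em C G
      open Classical (lower-em em)
      (m , v-card) = Prime⇒finite v-prime
      u-card = HasCard-∪-｛｝ v-card (x∉cmv ∘ ⊆-cm v)
      (A , A-rep) = Nonempty⇒∃DimRep (proj₁ v-prime)
      (α , A-card) = Prime⇒finite (proj₁ (proj₁ A-rep))
      (p , p⊆u , p-prime , p≈u) = prime-core (suc m) (HasCard⇒FinBounded u-card) (x , inj₂ refl)
      p-axial = u-maximal p p⊆u p-prime p≈u
      (π , p-card) = Prime⇒finite p-prime
      m≤α = Axial-≤ (proj₁ A-rep) v-prime (≐-sym (proj₂ A-rep)) v-card A-card
      α<π = dim-< inj₁ (λ u⊆cmv → x∉cmv (u⊆cmv (inj₂ refl))) A-rep (p-axial , p≈u)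
                  A-card p-card
      π≤1+m = HasCard-CardLeq⇒≤ p-card u-card (⊆⇒CardLeq p⊆u)
      u⊆p = ⊆-≥⇒⊇ p⊆u p-card u-card (≤-trans (s≤s m≤α) α<π)
      u-prime = Prime-resp-≐ (p⊆u , u⊆p) p-prime
      u-axial = u-maximal _ id u-prime ≐-refl
      α≤m = ≤-pred (≤-trans α<π π≤1+m)
      v-axial = DimRep-CardLeq⇒Axial v-prime A-rep (≤⇒CardLeq A-card v-card α≤m)
  in v-axial , u-axial , λ a b a-rep b-rep →
       HasCard⇒CardSucc (DimRep-HasCard v-axial a-rep v-card) (DimRep-HasCard u-axial b-rep u-card)
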